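{- Let $\langle R,\circ,\mathbin{ -\bullet},e,-,\infty\rangle$ be a unitary $\mathrm{AX}_{\mathrm{CBI}}$-model (so $e=\{e_0\}$ is a singleton). Then $\infty$ is a singleton set $\{\infty_0\}$, and $-x$ is a singleton set $\{x'\}$ for every $x\in R$. Moreover, writing $-x$ for the unique element $x'$, the tuple $\langle R,\circ,e_0,-,\infty_0\rangle$ is a CBI-model.
   Context: An $\mathrm{ML}_{\mathrm{CBI}}$ frame is a tuple $\langle R,\circ,\mathbin{ -\bullet},e,-,\infty\rangle$ with $\circ:R\times R\to\mathcal{P}(R)$, $\mathbin{ -\bullet}:\mathcal{P}(R)\times\mathcal{P}(R)\to\mathcal{P}(R)$, $e\subseteq R$, $-:R\to\mathcal{P}(R)$, $\infty\subseteq R$; $\circ$ and $-$ are extended pointwise to subsets ($X\circ Y=\bigcup_{x\in X,y\in Y}x\circ y$, $-X=\bigcup_{x\in X}-x$). It is unitary if $e$ is a singleton. Modal formulas: $A ::= P\mid\top\mid\bot\mid\neg A\mid A\wedge A\mid A\vee A\mid A\to A\mid e\mid\infty\mid -A\mid A\circ A\mid A\mathbin{ -\bullet}A$, $P$ ranging over propositional variables. Given an environment $\rho$ mapping variables to subsets of $R$: additive connectives are interpreted classically pointwise, $r\models_\rho P$ iff $r\in\rho(P)$; $r\models_\rho e$ iff $r\in e$; $r\models_\rho\infty$ iff $r\in\infty$; $r\models_\rho -A$ iff $\exists r'.\ r\in -r'$ and $r'\models_\rho A$; $r\models_\rho A_1\circ A_2$ iff $\exists r_1,r_2.\ r\in r_1\circ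 r_2$, $r_1\models_\rho A_1$, $r_2\models_\rho A_2$; $r\models_\rho A_1\mathbin{ -\bullet}A_2$ iff $\exists r_1,r_2.\ r\in\{r_1\}\mathbin{ -\bullet}\{r_2\}$, $r_1\models_\rho A_1$, $r_2\models_\rho A_2$. A formula is true in a frame if every point satisfies it under every environment. An $\mathrm{AX}_{\mathrm{CBI}}$-model is a frame in which the following are true (for propositional variables $P,Q,R$): (1) $e\circ P\to P$; (2) $P\to e\circ P$; (3) $P\circ Q\to Q\circ P$; (4) $(P\circ Q)\circ R\to P\circ(Q\circ R)$; (5) $P\circ(Q\circ R)\to(P\circ Q)\circ R$; (6) $Q\wedge(R\circ P)\to(R\wedge(P\mathbin{ -\bullet}Q))\circ\top$; (7) $R\wedge(P\mathbin{ -\bullet}Q)\to(\top\mathbin{ -\bullet}(Q\wedge(R\circ P)))$; (8) $--P\to P$; (9) $P\to --P$; (10) $-P\to(P\mathbin{ -\bullet}\infty)$; (11) $(P\mathbin{ -\bullet}\infty)\to -P$. A CBI-model is $\langle R,\circ,e,-,\infty\rangle$ with $e\in R$, $\circ:R\times R\to\mathcal{P}(R)$ commutative and associative (w.r.t. pointwise extension) with $r\circ e=\{r\}$ for all $r$, $-:R\to R$, $\infty\in R$, such that for each $x$, $-x$ is the unique element with $\infty\in x\circ(-x)$. -}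

module Defs where

open import Data.Nat using (ℕ)
open import Data.Product using (Σ; ∃; _×_; _,_)
open import Data.Sum using (_⊎_)
open import Data.Unit using (⊤)
open import Data.Empty using (⊥)
open import Relation.Nullary using (¬_)
open import Relation.Binary.PropositionalEquality using (_≡_)
open import Function.Bundles using (_⇔_)

Subset : Set → Set₁
Subset R = R → Set

⟨_⟩ : {R : Set} → R → Subset R
⟨ x ⟩ = λ y → y ≡ x

IsSingletonOf : {R : Set} → Subset R → R → Set
IsSingletonOf X x = ∀ y → X y ⇔ (y ≡ x)

-- ML_CBI frame ⟨R, ∘, -•, e, -, ∞⟩.
--   comp x y z  means  z ∈ x ∘ y
--   lolli X Y z means  z ∈ X -• Y
--   neg x y     means  y ∈ -x
record Frame (R : Set) : Set₁ where
  field
    comp  : R → R → Subset R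
    lolli : Subset R → Subset R → Subset R
    e     : Subset R
    neg   : R → Subset R
    inf   : Subset R

Unitary : {R : Set} → Frame R → Set
Unitary F = Σ _ λ e₀ → IsSingletonOf (Frame.e F) e₀

data Formula : Set where
  var   : ℕ → Formula
  tt ff : Formula
  ¬′_   : Formula → Formula
  _∧′_ _∨′_ _⇒′_ : Formula → Formula → Formula
  e′ ∞′ : Formula
  -′_   : Formula → Formula
  _∘′_  : Formula → Formula → Formula
  _-•′_ : Formula → Formula → Formula

infixr 4 _⇒′_
infixr 6 _∧′_ _∨′_
infixr 7 _∘′_ _-•′_
infix 8 ¬′_ -′_

module _ {R : Set} (F : Frame R) where
  open Frame F

  sat : (ℕ → Subset R) → Formula → Subset R
  sat ρ (var n) r = ρ n r
  sat ρ tt r = ⊤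
  sat ρ ff r = ⊥
  sat ρ (¬′ A) r = ¬ sat ρ A r
  sat ρ (A ∧′ B) r = sat ρ A r × sat ρ B r
  sat ρ (A ∨′ B) r = sat ρ A r ⊎ sat ρ B r
  sat ρ (A ⇒′ B) r = sat ρ A r → sat ρ B r
  sat ρ e′ r = e r
  sat ρ ∞′ r = inf r
  sat ρ (-′ A) r = ∃ λ r′ → neg r′ r × sat ρ A r′
  sat ρ (A ∘′ B) r = ∃ λ r₁ → ∃ λ r₂ → comp r₁ r₂ r × sat ρ A r₁ × sat ρ B r₂
  sat ρ (A -•′ B) r = ∃ λ r₁ → ∃ λ r₂ → lolli ⟨ r₁ ⟩ ⟨ r₂ ⟩ r × sat ρ A r₁ × sat ρ B r₂

  TrueIn : Formula → Set₁
  TrueIn A = ∀ (ρ : ℕ → Subset R) (r : R) → sat ρ A r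

P Q S : Formula
P = var 0
Q = var 1
S = var 2

record IsAXCBIModel {R : Set} (F : Frame R) : Set₁ where
  field
    ax1  : TrueIn F (e′ ∘′ P ⇒′ P)
    ax2  : TrueIn F (P ⇒′ e′ ∘′ P)
    ax3  : TrueIn F (P ∘′ Q ⇒′ Q ∘′ P)
    ax4  : TrueIn F ((P ∘′ Q) ∘′ S ⇒′ P ∘′ (Q ∘′ S))
    ax5  : TrueIn F (P ∘′ (Q ∘′ S) ⇒′ (P ∘′ Q) ∘′ S)
    ax6  : TrueIn F (Q ∧′ (S ∘′ P) ⇒′ (S ∧′ (P -•′ Q)) ∘′ tt)
    ax7  : TrueIn F (S ∧′ (P -•′ Q) ⇒′ (tt -•′ (Q ∧′ (S ∘′ P))))
    ax8  : TrueIn F (-′ -′ P ⇒′ P)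
    ax9  : TrueIn F (P ⇒′ -′ -′ P)
    ax10 : TrueIn F (-′ P ⇒′ (P -•′ ∞′))
    ax11 : TrueIn F ((P -•′ ∞′) ⇒′ -′ P)

-- CBI-model ⟨R, ∘, e, -, ∞⟩ (comp x y z means z ∈ x ∘ y).
record IsCBIModel (R : Set) (comp : R → R → Subset R) (e : R) (neg : R → R) (inf : R) : Set where
  field
    comm  : ∀ x y z → comp x y z ⇔ comp y x z
    -- associativity w.r.t. pointwise extension: (x ∘ y) ∘ z = x ∘ (y ∘ z)
    assoc : ∀ x y z r →
      (∃ λ w → comp x y w × comp w z r) ⇔ (∃ λ w → comp y z w × comp x w r)
    unit  : ∀ x z → comp x e z ⇔ (z ≡ x)
    neg-inf    : ∀ x → comp x (neg x) inf
    neg-unique : ∀ x y → comp x y inf → y ≡ neg x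

module Submission where

-- Every axiom is used at point-valued environments P ↦ {a}, Q ↦ {b},
-- S ↦ {c}, where it becomes a first-order fact about the relations comp,
-- lolli, neg and inf.  The development has two parts.
--
--  * In an arbitrary AX_CBI-model: (3)–(5) make comp commutative and
--    associative, (6)–(7) say that s ∈ {p} -• {q} iff q ∈ s ∘ p, and
--    with this (10)–(11) say that r ∈ -x iff r ∘ x meets ∞.  Hence
--    negation is symmetric; by (8) it is functional and by (9) total,
--    so every -x is a singleton {neg′ x}.
--  * If moreover e = {e₀}, axioms (1)–(2) give e₀ ∘ x = {x}.  Then
--    i ∈ ∞ iff i ∘ e₀ meets ∞ iff i ∈ -e₀, so ∞ = {neg′ e₀}, and
--    ∞ ∈ x ∘ y iff y = neg′ x.

open import Defs
open import Data.Product using (Σ; ∃; _×_; _,_; proj₁; proj₂)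
open import Data.Nat using (ℕ; zero; suc)
open import Data.Unit using (tt)
open import Function.Bundles using (_⇔_; mk⇔; Equivalence)
open import Relation.Binary.PropositionalEquality using (_≡_; refl; sym; subst)

open Equivalence using (to; from)

singleton-intro : {R : Set} {X : Subset R} {x : R} →
  X x → (∀ {y} → X y → y ≡ x) → IsSingletonOf X x
singleton-intro x∈X unique y = mk⇔ unique (λ { refl → x∈X })

pointEnv : {R : Set} → R → R → R → ℕ → Subset R
pointEnv a b c zero          = ⟨ a ⟩
pointEnv a b c (suc zero)    = ⟨ b ⟩
pointEnv a b c (suc (suc _)) = ⟨ c ⟩

module ModelFacts {R : Set} (F : Frame R) (M : IsAXCBIModel F) where
  open Frame F
  open IsAXCBIModel M

  comp-comm : ∀ {x y r} → comp x y r → comp y x r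
  comp-comm {x} {y} {r} c with ax3 (pointEnv x y y) r (x , y , c , refl , refl)
  ... | _ , _ , c′ , refl , refl = c′

  assoc-right : ∀ x y z r →
    (∃ λ w → comp x y w × comp w z r) → (∃ λ w → comp y z w × comp x w r)
  assoc-right x y z r (w , xy , wz)
    with ax4 (pointEnv x y z) r (w , z , wz , (x , y , xy , refl , refl) , refl)
  ... | _ , v , xv , refl , (_ , _ , yz , refl , refl) = v , yz , xv

  assoc-left : ∀ x y z r →
    (∃ λ w → comp y z w × comp x w r) → (∃ λ w → comp x y w × comp w z r)
  assoc-left x y z r (w , yz , xw)
    with ax5 (pointEnv x y z) r (x , w , xw , refl , (y , z , yz , refl , refl))
  ... | v , _ , vz , (_ , _ , xy , refl , refl) , refl = v , xy , vz

  lolli⇒comp : ∀ {p q s} → lolli ⟨ p ⟩ ⟨ q ⟩ s → comp s p q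
  lolli⇒comp {p} {q} {s} l
    with ax7 (pointEnv p q s) s (refl , (p , q , l , refl , refl))
  ... | _ , _ , _ , tt , (refl , (_ , _ , c , refl , refl)) = c

  comp⇒lolli : ∀ {p q s} → comp s p q → lolli ⟨ p ⟩ ⟨ q ⟩ s
  comp⇒lolli {p} {q} {s} c
    with ax6 (pointEnv p q s) q (refl , (s , p , c , refl , refl))
  ... | _ , _ , _ , (refl , (_ , _ , l , refl , refl)) , _ = l

  neg⇒inf : ∀ {x r} → neg x r → ∃ λ i → inf i × comp r x i
  neg⇒inf {x} {r} n with ax10 (pointEnv x x x) r (x , n , refl)
  ... | _ , i , l , refl , i∈∞ = i , i∈∞ , lolli⇒comp l

  inf⇒neg : ∀ {x r i} → inf i → comp r x i → neg x r
  inf⇒neg {x} {r} {i} i∈∞ c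
    with ax11 (pointEnv x x x) r (x , i , comp⇒lolli c , refl , i∈∞)
  ... | _ , n , refl = n

  -- By (10), (11) and commutativity, negation is a symmetric relation.
  neg-sym : ∀ {x y} → neg x y → neg y x
  neg-sym n with neg⇒inf n
  ... | i , i∈∞ , c = inf⇒neg i∈∞ (comp-comm c)

  neg-involutive : ∀ {x y z} → neg x y → neg y z → z ≡ x
  neg-involutive {x} {y} {z} xy yz = ax8 (pointEnv x x x) z (y , yz , (x , xy , refl))

  neg-functional : ∀ {x y y′} → neg x y → neg x y′ → y ≡ y′
  neg-functional xy xy′ = sym (neg-involutive (neg-sym xy) xy′)

  neg-total : ∀ x → ∃ λ y → neg x y
  neg-total x with ax9 (pointEnv x x x) x refl
  ... | y , yx , (_ , _ , refl) = y , neg-sym yx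

  neg′ : R → R
  neg′ x = proj₁ (neg-total x)

  neg′-correct : ∀ x → neg x (neg′ x)
  neg′-correct x = proj₂ (neg-total x)

  neg-singleton : ∀ x → IsSingletonOf (neg x) (neg′ x)
  neg-singleton x =
    singleton-intro (neg′-correct x) (λ n → neg-functional n (neg′-correct x))

module UnitaryFacts {R : Set} (F : Frame R) (M : IsAXCBIModel F) (u : Unitary F) where
  open Frame F
  open IsAXCBIModel M
  open ModelFacts F M

  e₀ : R
  e₀ = proj₁ u

  e₀∈e : e e₀
  e₀∈e = from (proj₂ u e₀) refl

  unit-absorb : ∀ {x r} → comp e₀ x r → r ≡ x
  unit-absorb {x} {r} c = ax1 (pointEnv x x x) r (e₀ , x , c , e₀∈e , refl)

  -- Axiom (2): x ∈ e₀ ∘ x, using that e₀ is the only unit.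
  unit-intro : ∀ x → comp e₀ x x
  unit-intro x with ax2 (pointEnv x x x) x refl
  ... | d , _ , c , d∈e , refl = subst (λ w → comp w x x) (to (proj₂ u d) d∈e) c

  right-unit : ∀ x z → comp x e₀ z ⇔ (z ≡ x)
  right-unit x z = mk⇔ (λ c → unit-absorb (comp-comm c)) (λ { refl → comp-comm (unit-intro x) })

  inf₀ : R
  inf₀ = neg′ e₀

  -- i ∈ ∞ gives i ∈ i ∘ e₀ meeting ∞, so i ∈ -e₀.
  inf-unique : ∀ {i} → inf i → i ≡ inf₀
  inf-unique {i} i∈∞ =
    neg-functional (inf⇒neg i∈∞ (comp-comm (unit-intro i))) (neg′-correct e₀)

  -- -e₀ ∘ e₀ = {-e₀} meets ∞.
  inf₀∈inf : inf inf₀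
  inf₀∈inf with neg⇒inf (neg′-correct e₀)
  ... | j , j∈∞ , c = subst inf (unit-absorb (comp-comm c)) j∈∞

  inf-singleton : IsSingletonOf inf inf₀
  inf-singleton = singleton-intro inf₀∈inf inf-unique

  neg-inf : ∀ x → comp x (neg′ x) inf₀
  neg-inf x with neg⇒inf (neg′-correct x)
  ... | i , i∈∞ , c = subst (comp x (neg′ x)) (inf-unique i∈∞) (comp-comm c)

  neg-unique : ∀ x y → comp x y inf₀ → y ≡ neg′ x
  neg-unique x y c = neg-functional (neg-sym (inf⇒neg inf₀∈inf c)) (neg′-correct x)

  isCBIModel : IsCBIModel R comp e₀ neg′ inf₀
  isCBIModel = record
    { comm       = λ x y z → mk⇔ comp-comm comp-comm
    ; assoc      = λ x y z r → mk⇔ (assoc-right x y z r) (assoc-left x y z r)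
    ; unit       = right-unit
    ; neg-inf    = neg-inf
    ; neg-unique = neg-unique
    }

lemma4p2p2 : (R : Set) (F : Frame R) → IsAXCBIModel F → (u : Unitary F) →
    Σ R λ inf₀ → IsSingletonOf (Frame.inf F) inf₀ ×
      Σ (R → R) λ neg′ → ((x : R) → IsSingletonOf (Frame.neg F x) (neg′ x)) ×
        IsCBIModel R (Frame.comp F) (Σ.proj₁ u) neg′ inf₀
lemma4p2p2 R F M u = inf₀ , inf-singleton , neg′ , neg-singleton , isCBIModel
  where
  open ModelFacts F M using (neg′; neg-singleton)
  open UnitaryFacts F M u using (inf₀; inf-singleton; isCBIModel)
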